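{- Let $p\ge 0$ be an integer and $A$ a finite set of positive integers with $\gcd(A)=1$. The following are equivalent: (i) $S_p(A)$ is $p$-almost symmetric, i.e. $L_p(A)\subseteq \mathrm{PF}_p(A)$; (ii) $\mathrm{PF}_p(A)=L_p(A)\cup\{g_p(A)\}$; (iii) for every integer $x\notin S_p(A)$, either $g_p(A)+\ell_0(p)-x\in S_p(A)$ or $x\in \mathrm{PF}_p(A)$.
   Context: For $A=\{a_1,\dots,a_k\}$ and $n\ge 0$, $d(n;A)$ is the number of $(x_1,\dots,x_k)\in\mathbb N_0^k$ with $\sum a_ix_i=n$. For $p\ge 0$, $S_p(A)=\{n\in\mathbb N_0:d(n;A)>p\}$, $G_p(A)=\mathbb N_0\setminus S_p(A)$, $g_p(A)=\max G_p(A)$, $\ell_0(p)=\min S_p(A)$. The set of $p$-pseudo-Frobenius numbers $\mathrm{PF}_p(A)$ is the set of integers $x\notin S_p(A)$ such that $x+s-\ell_0(p)\in S_p(A)$ for all $s\in S_p(A)\setminus\{\ell_0(p)\}$. Further $L_p(A)=\{s\in\mathbb Z: s\notin S_p(A)\text{ and } g_p(A)+\ell_0(p)-s\notin S_p(A)\}$. -}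

module Defs where

open import Data.Nat using (ℕ; zero; suc; _*_; _∸_; _<_; _≤ᵇ_)
open import Data.Nat.GCD using (gcd)
open import Data.Bool using (if_then_else_)
open import Data.List using (List; []; _∷_; map; upTo; foldr)
open import Data.Nat.ListAction using (sum)
open import Data.Integer as ℤ using (ℤ; +_)
open import Data.Product using (Σ; ∃; _×_)
open import Relation.Binary.PropositionalEquality using (_≡_)
open import Relation.Nullary using (¬_)

gcdList : List ℕ → ℕ
gcdList = foldr gcd 0

-- d(n; A): the number of (x_1,...,x_k) ∈ ℕ₀^k with Σ a_i x_i = n,
-- computed by recursion on A = a_1 ∷ ... ∷ a_k:
--   d(n; []) = 1 if n = 0, else 0
--   d(n; a ∷ A') = Σ_{x ≥ 0, x*a ≤ n} d(n - x*a; A')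
-- (for a ≥ 1 every admissible x satisfies x ≤ n, so x ranges over 0..n).
d : ℕ → List ℕ → ℕ
d zero    []       = 1
d (suc n) []       = 0
d n       (a ∷ as) =
  sum (map (λ x → if x * a ≤ᵇ n then d (n ∸ x * a) as else 0) (upTo (suc n)))

InS : ℕ → List ℕ → ℤ → Set
InS p A z = Σ ℕ λ n → (z ≡ + n) × (p < d n A)

-- g is g_p(A) = max G_p(A)  (with the convention g = -1 if G_p(A) = ∅)
IsGp : ℕ → List ℕ → ℤ → Set
IsGp p A g = ¬ InS p A g × (∀ (z : ℤ) → g ℤ.< z → InS p A z)

IsL0 : ℕ → List ℕ → ℤ → Set
IsL0 p A l = InS p A l × (∀ (z : ℤ) → InS p A z → l ℤ.≤ z)

InPF : ℕ → List ℕ → ℤ → ℤ → Set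
InPF p A l x = ¬ InS p A x × (∀ (s : ℤ) → InS p A s → ¬ (s ≡ l) → InS p A ((x ℤ.+ s) ℤ.- l))

InL : ℕ → List ℕ → ℤ → ℤ → ℤ → Set
InL p A g l s = ¬ InS p A s × ¬ InS p A ((g ℤ.+ l) ℤ.- s)

-- Whatever A is, g_p(A) is always p-pseudo-Frobenius: every s ∈ S_p(A) other than ℓ₀ exceeds ℓ₀,
-- so g + s − ℓ₀ > g lies in S_p(A). Conversely a p-pseudo-Frobenius x ≠ g lies in L_p(A): if
-- y = g + ℓ₀ − x were in S_p(A), then y ≠ ℓ₀ (as x ≠ g) and x + y − ℓ₀ = g would be in S_p(A).
-- Hence PF_p(A) ⊆ L_p(A) ∪ {g} always, which gives (i) ⇔ (ii); (i) ⇔ (iii) holds because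
-- membership in S_p(A) is decidable.
module Submission where

open import Defs
open import Data.Nat using (ℕ; _<_; _<?_)
open import Data.List using (List)
open import Data.List.Relation.Unary.All using (All)
open import Data.List.Relation.Unary.Unique.Propositional using (Unique)
open import Data.Integer as ℤ using (ℤ; +_; -[1+_])
import Data.Integer.Properties as ℤ
open import Data.Integer.Solver using (module +-*-Solver)
open import Data.Product using (_×_; _,_; proj₁; proj₂)
open import Data.Sum using (_⊎_; inj₁; inj₂)
open import Data.Empty using (⊥-elim)
open import Function.Base using (_∘_; case_of_)
open import Function.Bundles using (_⇔_; mk⇔; Equivalence)
open import Relation.Binary.PropositionalEquality using (_≡_; refl; sym; subst; subst₂; cong)
open import Relation.Nullary using (¬_; yes; no)
open import Relation.Unary using (Decidable)

open +-*-Solver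

[i+j]-j≡i : ∀ i j → (i ℤ.+ j) ℤ.- j ≡ i
[i+j]-j≡i = solve 2 (λ i j → (i :+ j) :- j := i) refl

i+[[j+k]-i]-k≡j : ∀ i j k → (i ℤ.+ ((j ℤ.+ k) ℤ.- i)) ℤ.- k ≡ j
i+[[j+k]-i]-k≡j = solve 3 (λ i j k → (i :+ ((j :+ k) :- i)) :- k := j) refl

i<[i+k]-j : ∀ i {j k} → j ℤ.< k → i ℤ.< (i ℤ.+ k) ℤ.- j
i<[i+k]-j i {j} {k} j<k =
  subst (ℤ._< (i ℤ.+ k) ℤ.- j) ([i+j]-j≡i i j) (ℤ.+-monoˡ-< (ℤ.- j) (ℤ.+-monoʳ-< i j<k))

InS? : ∀ p A → Decidable (InS p A)
InS? p A (+ n) with p <? d n A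
... | yes p<d = yes (n , refl , p<d)
... | no  p≮d = no λ { (_ , refl , p<d) → p≮d p<d }
InS? p A -[1+ n ] = no λ { (_ , () , _) }

module _ {p : ℕ} {A : List ℕ} {g l : ℤ} (isGp : IsGp p A g) (isL0 : IsL0 p A l) where

  gp∈PF : InPF p A l g
  gp∈PF = proj₁ isGp , λ s s∈S s≢l →
    proj₂ isGp _ (i<[i+k]-j g (ℤ.≤∧≢⇒< (proj₂ isL0 s s∈S) (s≢l ∘ sym)))

  PF⇒L⊎gp : ∀ x → InPF p A l x → InL p A g l x ⊎ x ≡ g
  PF⇒L⊎gp x (x∉S , x+S-l⊆S) with x ℤ.≟ g
  ... | yes x≡g = inj₂ x≡g
  ... | no  x≢g = inj₁ (x∉S , dual∉S)
    where
    dual∉S : ¬ InS p A ((g ℤ.+ l) ℤ.- x)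
    dual∉S dual∈S with (g ℤ.+ l) ℤ.- x ℤ.≟ l
    ... | yes dual≡l =
      x≢g (subst₂ _≡_ ([i+j]-j≡i x l) (i+[[j+k]-i]-k≡j x g l) (cong (λ y → (x ℤ.+ y) ℤ.- l) (sym dual≡l)))
    ... | no  dual≢l = proj₁ isGp (subst (InS p A) (i+[[j+k]-i]-k≡j x g l) (x+S-l⊆S _ dual∈S dual≢l))

proposition2 : (p : ℕ) (A : List ℕ) → Unique A → All (0 <_) A → gcdList A ≡ 1 →
    (g l : ℤ) → IsGp p A g → IsL0 p A l →
    ((∀ (x : ℤ) → InL p A g l x → InPF p A l x)
      ⇔ (∀ (x : ℤ) → InPF p A l x ⇔ (InL p A g l x ⊎ x ≡ g)))
    × ((∀ (x : ℤ) → InL p A g l x → InPF p A l x)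
      ⇔ (∀ (x : ℤ) → ¬ InS p A x → InS p A ((g ℤ.+ l) ℤ.- x) ⊎ InPF p A l x))
proposition2 p A _ _ _ g l isGp isL0 = mk⇔ i⇒ii ii⇒i , mk⇔ i⇒iii iii⇒i
  where
  AlmostSymmetric : Set
  AlmostSymmetric = ∀ x → InL p A g l x → InPF p A l x

  i⇒ii : AlmostSymmetric → ∀ x → InPF p A l x ⇔ (InL p A g l x ⊎ x ≡ g)
  i⇒ii L⊆PF x = mk⇔ (PF⇒L⊎gp isGp isL0 x) λ
    { (inj₁ x∈L) → L⊆PF x x∈L
    ; (inj₂ refl) → gp∈PF isGp isL0 }

  ii⇒i : (∀ x → InPF p A l x ⇔ (InL p A g l x ⊎ x ≡ g)) → AlmostSymmetric
  ii⇒i PF⇔L⊎gp x x∈L = Equivalence.from (PF⇔L⊎gp x) (inj₁ x∈L)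

  i⇒iii : AlmostSymmetric → ∀ x → ¬ InS p A x → InS p A ((g ℤ.+ l) ℤ.- x) ⊎ InPF p A l x
  i⇒iii L⊆PF x x∉S = case InS? p A ((g ℤ.+ l) ℤ.- x) of λ
    { (yes dual∈S) → inj₁ dual∈S
    ; (no  dual∉S) → inj₂ (L⊆PF x (x∉S , dual∉S)) }

  iii⇒i : (∀ x → ¬ InS p A x → InS p A ((g ℤ.+ l) ℤ.- x) ⊎ InPF p A l x) → AlmostSymmetric
  iii⇒i dichotomy x (x∉S , dual∉S) = case dichotomy x x∉S of λ
    { (inj₁ dual∈S) → ⊥-elim (dual∉S dual∈S)
    ; (inj₂ x∈PF)   → x∈PF }
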